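{- Let $G$ be a graph of order $n$ and size $m$ with $\delta(G)\geq 1$, having $e$ end-vertices, $p$ penultimate vertices, and non-increasing degree sequence $d_1\geq\cdots\geq d_n$. Then $$\gamma_{\times2}(G)\geq s\ell_{\times2}(G)\geq\frac{4n-2m+e-p}{3}.$$ Furthermore, $s\ell_{\times2}(G)=(4n-2m+e-p)/3$ if and only if $n+m+e-p\equiv 0\pmod 3$ and the following hold: (i) if $\delta(G)\geq 2$, then $d_q=2$, where $q=(4n-2m+3)/3$; (ii) if $\delta(G)=1$, then either $n=2m-e+p$, or ($n<2m-e+p$ and $d_q=2$, where $q=(4n-2m-2e-p+3)/3$).
   Context: An end-vertex is a vertex of degree one; a penultimate vertex is a vertex adjacent to an end-vertex. A double dominating set is a set $S\subseteq V(G)$ with $|N[v]\cap S|\geq2$ for all $v\in V(G)$ ($N[v]$ the closed neighborhood); $\gamma_{\times2}(G)$ is the minimum size of such a set. The double Slater number is $s\ell_{\times2}(G)=\min\{t\mid t+d_1+\cdots+d_{t-e}\geq 2n-p\}$. -}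

module Defs where

open import Data.Bool using (Bool; true; false; if_then_else_; _∧_; _∨_; not)
open import Data.Nat using (ℕ; zero; suc; _+_; _*_; _∸_; _≤_; _<ᵇ_; _≤ᵇ_; _≡ᵇ_)
open import Data.Nat.Properties using (≤-decTotalOrder)
open import Data.Fin using (Fin; toℕ)
open import Data.Fin.Properties using (_≟_)
open import Data.List using (List; []; _∷_; map; allFin; reverse; take)
open import Data.Nat.ListAction using (sum)
open import Data.List.Sort ≤-decTotalOrder using (sort)
open import Data.Product using (Σ; _×_; ∃; _,_)
open import Relation.Binary.PropositionalEquality using (_≡_)
open import Relation.Nullary.Decidable using (⌊_⌋)

record Graph (n : ℕ) : Set where
  field
    adj    : Fin n → Fin n → Bool
    sym    : ∀ i j → adj i j ≡ adj j i
    irrefl : ∀ i → adj i i ≡ false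
open Graph public

count : ∀ {n} → (Fin n → Bool) → ℕ
count {n} f = sum (map (λ i → if f i then 1 else 0) (allFin n))

deg : ∀ {n} → Graph n → Fin n → ℕ
deg G v = count (adj G v)

size : ∀ {n} → Graph n → ℕ
size {n} G = sum (map (λ i → count (λ j → (toℕ i <ᵇ toℕ j) ∧ adj G i j)) (allFin n))

isEnd : ∀ {n} → Graph n → Fin n → Bool
isEnd G v = deg G v ≡ᵇ 1

ends : ∀ {n} → Graph n → ℕ
ends G = count (isEnd G)

penults : ∀ {n} → Graph n → ℕ
penults G = count (λ v → 0 <ᵇ count (λ u → adj G v u ∧ isEnd G u))

degSeq : ∀ {n} → Graph n → List ℕ
degSeq {n} G = reverse (sort (map (deg G) (allFin n)))

-- 1-based access d_k (0 outside the range 1..n, never used there in the statement)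
nth1 : List ℕ → ℕ → ℕ
nth1 []       _             = 0
nth1 (x ∷ xs) zero          = 0
nth1 (x ∷ xs) (suc zero)    = x
nth1 (x ∷ xs) (suc (suc k)) = nth1 xs (suc k)

d : ∀ {n} → Graph n → ℕ → ℕ
d G k = nth1 (degSeq G) k

dsum : ∀ {n} → Graph n → ℕ → ℕ
dsum G j = sum (take j (degSeq G))

SlCond : ∀ {n} → Graph n → ℕ → Bool
SlCond {n} G t = (2 * n ∸ penults G) ≤ᵇ (t + dsum G (t ∸ ends G))

searchFrom : (ℕ → Bool) → ℕ → ℕ → ℕ
searchFrom P zero     t = t
searchFrom P (suc f)  t = if P t then t else searchFrom P f (suc t)

-- sℓ×2(G) = min { t ∈ ℕ | t + d₁ + ⋯ + d_{t-e} ≥ 2n - p }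
-- (t = 2n always satisfies the condition, so searching 0..2n finds the minimum)
slater2 : ∀ {n} → Graph n → ℕ
slater2 {n} G = searchFrom (SlCond G) (2 * n) 0

inClosedNbhd : ∀ {n} → Graph n → Fin n → Fin n → Bool
inClosedNbhd G v u = ⌊ u ≟ v ⌋ ∨ adj G v u

IsDoubleDominating : ∀ {n} → Graph n → (Fin n → Bool) → Set
IsDoubleDominating G S = ∀ v → 2 ≤ count (λ u → inClosedNbhd G v u ∧ S u)

IsDoubleDomNumber : ∀ {n} → Graph n → ℕ → Set
IsDoubleDomNumber G k =
  (Σ _ λ S → IsDoubleDominating G S × count S ≡ k) ×
  (∀ S → IsDoubleDominating G S → k ≤ count S)

-- Let t = sℓ×2(G) and write the degree sequence as d₁ ≥ ⋯ ≥ d_a ≥ 2 followed by e ones.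
--
-- γ×2 ≥ sℓ×2: let S be double dominating. An end-vertex u has |N[u]| = 2, so N[u] ⊆ S; hence every
-- end-vertex and every penultimate vertex lies in S, and |N[v] ∩ S| ≥ 2 + (number of end-neighbours of v)
-- − [v penultimate]. Summing over v gives Σ_v |N[v] ∩ S| ≥ 2n + e − p, while double counting gives
-- Σ_v |N[v] ∩ S| = |S| + Σ_{u ∈ S} deg u ≤ |S| + e + d₁ + ⋯ + d_{|S|−e}. So |S| satisfies the defining
-- condition of sℓ×2.
--
-- 3 sℓ×2 ≥ 4n − 2m + e − p: with t = e + k, the defining condition at t, 2m = d₁ + ⋯ + d_a + e and d_i ≥ 2
-- give 3t + 2m + p = 4n + e + s₁ + s₂, where s₁ is the slack of the condition at t and
-- s₂ = d_{k+1} + ⋯ + d_a − 2(a − k). Equality forces s₂ = 0, i.e. d_{k+1} = 2 when k < a, and then q = k + 1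
-- satisfies (i) resp. (ii); when k = a it forces n = 2m − e + p, which is impossible if δ(G) ≥ 2 since then
-- 2m ≥ 2n. Conversely, such a q (or n = 2m − e + p) yields some t₀ satisfying the condition with
-- 3t₀ + 2m + p = 4n + e, and the minimality of t together with the lower bound squeezes 3t + 2m + p to 4n + e.

module Submission where

open import Defs renaming (sym to adj-sym)
import Algebra.Properties.CommutativeMonoid.Sum as FinSum
open import Data.Bool using (Bool; true; false; if_then_else_; _∧_; _∨_; not; T)
open import Data.Bool.Properties using (∧-identityʳ; ∧-zeroʳ; ∨-zeroʳ; ∧-conicalˡ; ∧-conicalʳ; T-≡)
open import Data.Empty using (⊥-elim)
open import Data.Fin using (Fin; zero; suc; toℕ)
open import Data.Fin.Properties using (_≟_; any?)
import Data.Fin.Properties as Fin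
import Data.Integer as ℤ
import Data.Integer.Properties as ℤₚ
open import Data.Integer.Divisibility using (_∣_; divides)
import Data.Integer.Tactic.RingSolver as ℤ-Ring
open import Data.List using (List; []; _∷_; _++_; take; drop; replicate; reverse; length; map; tabulate; allFin)
import Data.List.Properties as List
open import Data.List.Relation.Binary.Permutation.Propositional using (_↭_; ↭-sym; ↭-trans; ↭⇒↭ₛ)
open import Data.List.Relation.Binary.Permutation.Propositional.Properties using (↭-reverse; ↭-length; All-resp-↭)
import Data.List.Relation.Binary.Permutation.Propositional.Properties as Perm
open import Data.List.Relation.Binary.Pointwise using (Pointwise-≡⇒≡)
open import Data.List.Relation.Unary.All as All using (All; []; _∷_)
import Data.List.Relation.Unary.All.Properties as All
open import Data.List.Relation.Unary.AllPairs using (AllPairs; []; _∷_)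
import Data.List.Relation.Unary.AllPairs.Properties as AllPairs
open import Data.List.Relation.Unary.Sorted.TotalOrder.Properties using (AllPairs⇒Sorted; Sorted⇒AllPairs; ↗↭↗⇒≋)
open import Data.Nat using (ℕ; zero; suc; _+_; _*_; _∸_; _≤_; _<_; _≥_; _<?_; _≤ᵇ_; _<ᵇ_; _≡ᵇ_; z≤n; s≤s)
open import Data.Nat.ListAction using (sum)
open import Data.Nat.ListAction.Properties using (sum-++; sum-↭)
open import Data.Nat.Properties hiding (_≟_)
open import Data.Nat.Properties using () renaming (_≟_ to _≟ℕ_)
open import Algebra.Properties.CommutativeSemigroup +-commutativeSemigroup using (x∙yz≈y∙xz)
open import Data.Nat.Tactic.RingSolver using (solve-∀)
open import Data.List.Sort ≤-decTotalOrder using (sort; sort-↭; sort-↗)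
open import Relation.Binary.Properties.DecTotalOrder ≤-decTotalOrder using (≥-decTotalOrder; ≥-totalOrder)
open import Data.List.Sort.InsertionSort ≥-decTotalOrder using () renaming (insert to insert≥; sort to sort≥)
open import Data.List.Sort.InsertionSort.Properties ≥-decTotalOrder using ()
  renaming (sort-↭ to sort≥-↭; sort-↗ to sort≥-↘)
open import Data.Product using (Σ; ∃; _×_; _,_; proj₁; proj₂)
open import Data.Sum using (_⊎_; inj₁; inj₂)
open import Function using (_∘_; flip)
open import Function.Bundles using (_⇔_; mk⇔; Equivalence)
open import Relation.Binary.PropositionalEquality
open import Relation.Nullary using (Dec; yes; no; ¬_)
open import Relation.Nullary.Decidable using (⌊_⌋)
open import Relation.Nullary.Reflects using (ofʸ; ofⁿ)

open FinSum +-0-commutativeMonoid using (sum-syntax; ∑-distrib-+; ∑-comm; sum-cong-≗) renaming (sum to ∑)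

-- Finite sums and counting

⟦_⟧ : Bool → ℕ
⟦ b ⟧ = if b then 1 else 0

⟦⟧≤1 : ∀ b → ⟦ b ⟧ ≤ 1
⟦⟧≤1 true  = ≤-refl
⟦⟧≤1 false = z≤n

sum-tabulate : ∀ {n} (f : Fin n → ℕ) → sum (tabulate f) ≡ ∑[ i < n ] f i
sum-tabulate {zero}  f = refl
sum-tabulate {suc n} f = cong (f zero +_) (sum-tabulate (λ i → f (suc i)))

sum-map-allFin : ∀ {n} (f : Fin n → ℕ) → sum (map f (allFin n)) ≡ ∑[ i < n ] f i
sum-map-allFin f = trans (cong sum (List.map-tabulate (λ i → i) f)) (sum-tabulate f)

count≡∑ : ∀ {n} (f : Fin n → Bool) → count f ≡ ∑[ i < n ] ⟦ f i ⟧
count≡∑ f = sum-map-allFin (λ i → ⟦ f i ⟧)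

∑-mono-≤ : ∀ {n} {f g : Fin n → ℕ} → (∀ i → f i ≤ g i) → ∑[ i < n ] f i ≤ ∑[ i < n ] g i
∑-mono-≤ {zero}  f≤g = z≤n
∑-mono-≤ {suc n} f≤g = +-mono-≤ (f≤g zero) (∑-mono-≤ (λ i → f≤g (suc i)))

∑-zero : ∀ {n} {f : Fin n → ℕ} → (∀ i → f i ≡ 0) → ∑[ i < n ] f i ≡ 0
∑-zero {zero}  f≡0 = refl
∑-zero {suc n} f≡0 = cong₂ _+_ (f≡0 zero) (∑-zero (λ i → f≡0 (suc i)))

∑-const : ∀ n c → ∑[ i < n ] c ≡ n * c
∑-const zero    c = refl
∑-const (suc n) c = cong (c +_) (∑-const n c)

∑-supported-at : ∀ {n} {f : Fin n → ℕ} v → (∀ u → u ≢ v → f u ≡ 0) → ∑[ i < n ] f i ≡ f v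
∑-supported-at {suc n} {f} zero    f≡0 = trans (cong (f zero +_) (∑-zero (λ i → f≡0 (suc i) λ ()))) (+-identityʳ _)
∑-supported-at {suc n} {f} (suc v) f≡0 =
  cong₂ _+_ (f≡0 zero λ ()) (∑-supported-at {f = f ∘ suc} v λ u u≢v → f≡0 (suc u) (u≢v ∘ Fin.suc-injective))

term≤∑ : ∀ {n} (f : Fin n → ℕ) v → f v ≤ ∑[ i < n ] f i
term≤∑ f zero    = m≤m+n _ _
term≤∑ f (suc v) = ≤-trans (term≤∑ (λ i → f (suc i)) v) (m≤n+m _ _)

module _ {n : ℕ} where

  count-split : ∀ (f g : Fin n → Bool) → count f ≡ count (λ x → f x ∧ g x) + count (λ x → f x ∧ not (g x))
  count-split f g = begin
    count f                                              ≡⟨ count≡∑ f ⟩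
    ∑[ x < n ] ⟦ f x ⟧                                   ≡⟨ sum-cong-≗ split ⟩
    ∑[ x < n ] (⟦ f x ∧ g x ⟧ + ⟦ f x ∧ not (g x) ⟧)
      ≡⟨ ∑-distrib-+ (λ x → ⟦ f x ∧ g x ⟧) (λ x → ⟦ f x ∧ not (g x) ⟧) ⟩
    ∑[ x < n ] ⟦ f x ∧ g x ⟧ + ∑[ x < n ] ⟦ f x ∧ not (g x) ⟧
      ≡⟨ sym (cong₂ _+_ (count≡∑ (λ x → f x ∧ g x)) (count≡∑ (λ x → f x ∧ not (g x)))) ⟩
    count (λ x → f x ∧ g x) + count (λ x → f x ∧ not (g x)) ∎
    where
    open ≡-Reasoning
    split : ∀ x → ⟦ f x ⟧ ≡ ⟦ f x ∧ g x ⟧ + ⟦ f x ∧ not (g x) ⟧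
    split x with f x | g x
    ... | true  | true  = refl
    ... | true  | false = refl
    ... | false | _     = refl

  count-mono : ∀ {f g : Fin n → Bool} → (∀ x → f x ≡ true → g x ≡ true) → count f ≤ count g
  count-mono {f} {g} f⊆g = subst₂ _≤_ (sym (count≡∑ f)) (sym (count≡∑ g)) (∑-mono-≤ pointwise)
    where
    pointwise : ∀ x → ⟦ f x ⟧ ≤ ⟦ g x ⟧
    pointwise x with f x in fx
    ... | true  = ≤-reflexive (cong ⟦_⟧ (sym (f⊆g x fx)))
    ... | false = z≤n

  count-pos : ∀ {f : Fin n → Bool} w → f w ≡ true → 0 < count f
  count-pos {f} w fw = subst₂ _≤_ (cong ⟦_⟧ fw) (sym (count≡∑ f)) (term≤∑ (λ x → ⟦ f x ⟧) w)

  count≤n : ∀ (f : Fin n → Bool) → count f ≤ n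
  count≤n f = subst₂ _≤_ (sym (count≡∑ f)) (trans (∑-const n 1) (*-identityʳ n)) (∑-mono-≤ (λ x → ⟦⟧≤1 (f x)))

  count-true : count {n} (λ _ → true) ≡ n
  count-true = trans (count≡∑ {n} _) (trans (∑-const n 1) (*-identityʳ n))

  count-false : ∀ {f : Fin n → Bool} → (∀ x → f x ≡ false) → count f ≡ 0
  count-false {f} f≡false = trans (count≡∑ f) (∑-zero (λ x → cong ⟦_⟧ (f≡false x)))

  count-cong : ∀ {f g : Fin n → Bool} → (∀ x → f x ≡ g x) → count f ≡ count g
  count-cong {f} {g} f≗g = trans (count≡∑ f) (trans (sum-cong-≗ (λ x → cong ⟦_⟧ (f≗g x))) (sym (count≡∑ g)))

  count-∧-< : ∀ {f g : Fin n → Bool} w → f w ≡ true → g w ≡ false → count (λ x → f x ∧ g x) < count f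
  count-∧-< {f} {g} w fw gw = subst (count (λ x → f x ∧ g x) <_) (sym (count-split f g))
    (m<m+n _ (count-pos {f = λ x → f x ∧ not (g x)} w (cong₂ _∧_ fw (cong not gw))))

  count-witness : ∀ (f : Fin n → Bool) → 0 < count f → ∃ λ w → f w ≡ true
  count-witness f pos = ∑-witness f (subst (0 <_) (count≡∑ f) pos)
    where
    ∑-witness : ∀ {n} (f : Fin n → Bool) → 0 < ∑[ i < n ] ⟦ f i ⟧ → ∃ λ w → f w ≡ true
    ∑-witness {suc n} f pos with f zero in f0
    ... | true  = zero , f0
    ... | false = let w , fw = ∑-witness (f ∘ suc) pos in suc w , fw

∑-∧-const : ∀ {n} (f : Fin n → Bool) b → ∑[ i < n ] ⟦ f i ∧ b ⟧ ≡ (if b then count f else 0)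
∑-∧-const f true  = trans (sum-cong-≗ (λ i → cong ⟦_⟧ (∧-identityʳ (f i)))) (sym (count≡∑ f))
∑-∧-const f false = ∑-zero (λ i → cong ⟦_⟧ (∧-zeroʳ (f i)))

-- Double counting in a graph

⟦⟧-split-<ᵇ : ∀ x y b → (x ≡ y → b ≡ false) → ⟦ b ⟧ ≡ ⟦ (x <ᵇ y) ∧ b ⟧ + ⟦ (y <ᵇ x) ∧ b ⟧
⟦⟧-split-<ᵇ x y b x≡y⇒¬b with x <ᵇ y | <ᵇ-reflects-< x y | y <ᵇ x | <ᵇ-reflects-< y x
... | true  | ofʸ x<y | true  | ofʸ y<x = ⊥-elim (<-asym x<y y<x)
... | true  | _       | false | _       = sym (+-identityʳ _)
... | false | _       | true  | _       = refl
... | false | ofⁿ x≮y | false | ofⁿ y≮x = cong ⟦_⟧ (x≡y⇒¬b (≤-antisym (≮⇒≥ y≮x) (≮⇒≥ x≮y)))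

⌊≟⌋-refl : ∀ {n} (v : Fin n) → ⌊ v ≟ v ⌋ ≡ true
⌊≟⌋-refl v with v ≟ v
... | yes _  = refl
... | no v≢v = ⊥-elim (v≢v refl)

module _ {n : ℕ} (G : Graph n) where

  degreeSum : (Fin n → Bool) → ℕ
  degreeSum S = ∑[ u < n ] (if S u then deg G u else 0)

  ∑-count-adj : ∀ (S : Fin n → Bool) → ∑[ v < n ] count (λ u → adj G v u ∧ S u) ≡ degreeSum S
  ∑-count-adj S = begin
    ∑[ v < n ] count (λ u → adj G v u ∧ S u)     ≡⟨ sum-cong-≗ (λ v → count≡∑ (λ u → adj G v u ∧ S u)) ⟩
    ∑[ v < n ] ∑[ u < n ] ⟦ adj G v u ∧ S u ⟧    ≡⟨ ∑-comm (λ v u → ⟦ adj G v u ∧ S u ⟧) ⟩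
    ∑[ u < n ] ∑[ v < n ] ⟦ adj G v u ∧ S u ⟧
      ≡⟨ sum-cong-≗ (λ u → sum-cong-≗ (λ v → cong (λ b → ⟦ b ∧ S u ⟧) (adj-sym G v u))) ⟩
    ∑[ u < n ] ∑[ v < n ] ⟦ adj G u v ∧ S u ⟧    ≡⟨ sum-cong-≗ (λ u → ∑-∧-const (adj G u) (S u)) ⟩
    degreeSum S                                   ∎
    where open ≡-Reasoning

  handshake : ∑[ v < n ] deg G v ≡ 2 * size G
  handshake = begin
    ∑[ v < n ] deg G v                       ≡⟨ sum-cong-≗ (λ v → trans (count≡∑ (adj G v)) (sum-cong-≗ (split v))) ⟩
    ∑[ v < n ] ∑[ u < n ] (up v u + up u v)  ≡⟨ sum-cong-≗ (λ v → ∑-distrib-+ (up v) (λ u → up u v)) ⟩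
    ∑[ v < n ] (∑[ u < n ] up v u + ∑[ u < n ] up u v)
      ≡⟨ ∑-distrib-+ (λ v → ∑[ u < n ] up v u) (λ v → ∑[ u < n ] up u v) ⟩
    ∑[ v < n ] ∑[ u < n ] up v u + ∑[ v < n ] ∑[ u < n ] up u v
      ≡⟨ cong (∑[ v < n ] ∑[ u < n ] up v u +_) (∑-comm (λ v u → up u v)) ⟩
    ∑[ v < n ] ∑[ u < n ] up v u + ∑[ v < n ] ∑[ u < n ] up v u  ≡⟨ cong₂ _+_ size≡ size≡ ⟨
    size G + size G                                               ≡⟨ cong (size G +_) (+-identityʳ (size G)) ⟨
    2 * size G                                                    ∎
    where
    open ≡-Reasoning
    up : Fin n → Fin n → ℕ
    up v u = ⟦ (toℕ v <ᵇ toℕ u) ∧ adj G v u ⟧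
    size≡ : size G ≡ ∑[ v < n ] ∑[ u < n ] up v u
    size≡ = trans (sum-map-allFin (λ v → count (λ u → (toℕ v <ᵇ toℕ u) ∧ adj G v u)))
                  (sum-cong-≗ (λ v → count≡∑ (λ u → (toℕ v <ᵇ toℕ u) ∧ adj G v u)))
    split : ∀ v u → ⟦ adj G v u ⟧ ≡ up v u + up u v
    split v u = trans (⟦⟧-split-<ᵇ (toℕ v) (toℕ u) (adj G v u) v≡u⇒¬adj)
                      (cong (λ b → up v u + ⟦ (toℕ u <ᵇ toℕ v) ∧ b ⟧) (adj-sym G v u))
      where
      v≡u⇒¬adj : toℕ v ≡ toℕ u → adj G v u ≡ false
      v≡u⇒¬adj v≡u rewrite Fin.toℕ-injective v≡u = irrefl G u

  count-closedNbhd : ∀ v (S : Fin n → Bool) →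
    count (λ u → inClosedNbhd G v u ∧ S u) ≡ ⟦ S v ⟧ + count (λ u → adj G v u ∧ S u)
  count-closedNbhd v S = begin
    count (λ u → inClosedNbhd G v u ∧ S u)                        ≡⟨ count≡∑ (λ u → inClosedNbhd G v u ∧ S u) ⟩
    ∑[ u < n ] ⟦ inClosedNbhd G v u ∧ S u ⟧                        ≡⟨ sum-cong-≗ split ⟩
    ∑[ u < n ] (⟦ ⌊ u ≟ v ⌋ ∧ S u ⟧ + ⟦ adj G v u ∧ S u ⟧)
      ≡⟨ ∑-distrib-+ (λ u → ⟦ ⌊ u ≟ v ⌋ ∧ S u ⟧) (λ u → ⟦ adj G v u ∧ S u ⟧) ⟩
    ∑[ u < n ] ⟦ ⌊ u ≟ v ⌋ ∧ S u ⟧ + ∑[ u < n ] ⟦ adj G v u ∧ S u ⟧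
      ≡⟨ cong₂ _+_ (∑-supported-at v only-v) (sym (count≡∑ (λ u → adj G v u ∧ S u))) ⟩
    ⟦ ⌊ v ≟ v ⌋ ∧ S v ⟧ + count (λ u → adj G v u ∧ S u)
      ≡⟨ cong (λ b → ⟦ b ∧ S v ⟧ + count (λ u → adj G v u ∧ S u)) (⌊≟⌋-refl v) ⟩
    ⟦ S v ⟧ + count (λ u → adj G v u ∧ S u)                        ∎
    where
    open ≡-Reasoning
    split : ∀ u → ⟦ inClosedNbhd G v u ∧ S u ⟧ ≡ ⟦ ⌊ u ≟ v ⌋ ∧ S u ⟧ + ⟦ adj G v u ∧ S u ⟧
    split u with u ≟ v
    ... | yes refl rewrite irrefl G u = sym (+-identityʳ _)
    ... | no _     = refl
    only-v : ∀ u → u ≢ v → ⟦ ⌊ u ≟ v ⌋ ∧ S u ⟧ ≡ 0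
    only-v u u≢v with u ≟ v
    ... | yes u≡v = ⊥-elim (u≢v u≡v)
    ... | no _    = refl

  isEnd⇒deg≡1 : ∀ {u} → isEnd G u ≡ true → deg G u ≡ 1
  isEnd⇒deg≡1 {u} end = ≡ᵇ⇒≡ (deg G u) 1 (subst T (sym end) _)

  endNeighbours : Fin n → ℕ
  endNeighbours v = count (λ u → adj G v u ∧ isEnd G u)

  degreeSum-ends : degreeSum (isEnd G) ≡ ends G
  degreeSum-ends = trans (sum-cong-≗ degree-one) (sym (count≡∑ (isEnd G)))
    where
    degree-one : ∀ u → (if isEnd G u then deg G u else 0) ≡ ⟦ isEnd G u ⟧
    degree-one u with isEnd G u in end
    ... | true  = isEnd⇒deg≡1 end
    ... | false = refl

  ∑-endNeighbours : ∑[ v < n ] endNeighbours v ≡ ends G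
  ∑-endNeighbours = trans (∑-count-adj (isEnd G)) degreeSum-ends

  module _ (δ≥2 : ∀ v → 2 ≤ deg G v) where

    private
      not-end : ∀ v → isEnd G v ≡ false
      not-end v with deg G v | δ≥2 v
      ... | suc (suc _) | _           = refl
      ... | suc zero    | s≤s ()

    ends≡0 : ends G ≡ 0
    ends≡0 = count-false not-end

    penults≡0 : penults G ≡ 0
    penults≡0 = count-false λ v → cong (0 <ᵇ_) (count-false λ u → trans (cong (adj G v u ∧_) (not-end u)) (∧-zeroʳ _))

    2n≤2m : 2 * n ≤ 2 * size G
    2n≤2m = subst₂ _≤_ (trans (∑-const n 2) (*-comm n 2)) handshake (∑-mono-≤ δ≥2)

-- Sorting in non-increasing order

Descending : List ℕ → Set
Descending = AllPairs _≥_

sort≥-descending : ∀ xs → Descending (sort≥ xs)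
sort≥-descending xs = Sorted⇒AllPairs ≥-totalOrder (sort≥-↘ xs)

AllPairs-reverse⁺ : ∀ {A : Set} {R : A → A → Set} {xs} → AllPairs R xs → AllPairs (flip R) (reverse xs)
AllPairs-reverse⁺ {xs = []}     []           = []
AllPairs-reverse⁺ {xs = x ∷ xs} (x~xs ∷ pxs) rewrite List.unfold-reverse x xs =
  AllPairs.++⁺ (AllPairs-reverse⁺ pxs) ([] ∷ []) (All.map (_∷ []) (All-resp-↭ (↭-sym (↭-reverse xs)) x~xs))

reverse-sort≡sort≥ : ∀ xs → reverse (sort xs) ≡ sort≥ xs
reverse-sort≡sort≥ xs = Pointwise-≡⇒≡ (↗↭↗⇒≋ ≥-totalOrder
  (AllPairs⇒Sorted ≥-totalOrder (AllPairs-reverse⁺ (Sorted⇒AllPairs ≤-totalOrder (sort-↗ xs))))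
  (sort≥-↘ xs)
  (↭⇒↭ₛ (↭-trans (↭-reverse (sort xs)) (↭-trans (sort-↭ xs) (↭-sym (sort≥-↭ xs))))))

sum-take-≤-cons : ∀ {x} ys r → All (_≤ x) ys → Descending ys → sum (take r ys) ≤ sum (take r (x ∷ ys))
sum-take-≤-cons ys      zero    _             _          = z≤n
sum-take-≤-cons []      (suc r) _             _          = z≤n
sum-take-≤-cons (y ∷ ys) (suc r) (y≤x ∷ _) (y≥ys ∷ dys) = +-mono-≤ y≤x (sum-take-≤-cons ys r y≥ys dys)

sum-take-insert≥ : ∀ x ys r → x + sum (take r ys) ≤ sum (take (suc r) (insert≥ x ys))
sum-take-insert≥ x []       r = ≤-refl
sum-take-insert≥ x (y ∷ ys) r with y ≤ᵇ x | ≤ᵇ-reflects-≤ y x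
... | true  | _       = ≤-refl
sum-take-insert≥ x (y ∷ ys) zero    | false | ofⁿ y≰x = +-monoˡ-≤ 0 (<⇒≤ (≰⇒> y≰x))
sum-take-insert≥ x (y ∷ ys) (suc r) | false | _       = begin
  x + (y + sum (take r ys))  ≡⟨ x∙yz≈y∙xz x y _ ⟩
  y + (x + sum (take r ys))  ≤⟨ +-monoʳ-≤ y (sum-take-insert≥ x ys r) ⟩
  y + sum (take (suc r) (insert≥ x ys)) ∎
  where open ≤-Reasoning

sum-take-≤-insert≥ : ∀ x ys r → Descending ys → sum (take r ys) ≤ sum (take r (insert≥ x ys))
sum-take-≤-insert≥ x []       zero    _ = z≤n
sum-take-≤-insert≥ x []       (suc r) _ = z≤n
sum-take-≤-insert≥ x (y ∷ ys) r dys with y ≤ᵇ x | ≤ᵇ-reflects-≤ y x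
sum-take-≤-insert≥ x (y ∷ ys) zero    dys            | _     | _       = z≤n
sum-take-≤-insert≥ x (y ∷ ys) (suc r) (y≥ys ∷ dys) | true  | ofʸ y≤x = +-mono-≤ y≤x (sum-take-≤-cons ys r y≥ys dys)
sum-take-≤-insert≥ x (y ∷ ys) (suc r) (_ ∷ dys)    | false | _       = +-monoʳ-≤ y (sum-take-≤-insert≥ x ys r dys)

sum-select≤sum-take-sort≥ : ∀ {A : Set} (S : A → Bool) (g : A → ℕ) xs →
  sum (map (λ x → if S x then g x else 0) xs) ≤ sum (take (sum (map (λ x → ⟦ S x ⟧) xs)) (sort≥ (map g xs)))
sum-select≤sum-take-sort≥ S g []       = z≤n
sum-select≤sum-take-sort≥ S g (x ∷ xs) with S x
... | true  = ≤-trans (+-monoʳ-≤ (g x) (sum-select≤sum-take-sort≥ S g xs))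
                    (sum-take-insert≥ (g x) (sort≥ (map g xs)) (sum (map (λ x → ⟦ S x ⟧) xs)))
... | false = ≤-trans (sum-select≤sum-take-sort≥ S g xs)
                    (sum-take-≤-insert≥ (g x) (sort≥ (map g xs)) (sum (map (λ x → ⟦ S x ⟧) xs)) (sort≥-descending (map g xs)))

-- Non-increasing lists of positive integers

countOnes : List ℕ → ℕ
countOnes xs = sum (map (λ x → ⟦ x ≡ᵇ 1 ⟧) xs)

descending-split-ones : ∀ xs → Descending xs → All (1 ≤_) xs →
  Σ (List ℕ) λ ys → xs ≡ ys ++ replicate (countOnes xs) 1 × All (2 ≤_) ys × Descending ys
descending-split-ones []                 _              _            = [] , refl , [] , []
descending-split-ones (1 ∷ xs)           (1≥xs ∷ dxs)  (_ ∷ xs≥1) with descending-split-ones xs dxs xs≥1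
... | []     , xs≡ , _           , _ = [] , cong (1 ∷_) xs≡ , [] , []
... | y ∷ ys , xs≡ , (y≥2 ∷ _) , _ = ⊥-elim (<⇒≱ y≥2 (All.head (subst (All (_≤ 1)) xs≡ 1≥xs)))
descending-split-ones (suc (suc x) ∷ xs) (x≥xs ∷ dxs)  (_ ∷ xs≥1) with descending-split-ones xs dxs xs≥1
... | ys , xs≡ , ys≥2 , dys =
  suc (suc x) ∷ ys , cong (suc (suc x) ∷_) xs≡ , s≤s (s≤s z≤n) ∷ ys≥2 ,
  All.++⁻ˡ ys (subst (All (_≤ suc (suc x))) xs≡ x≥xs) ∷ dys

sum-replicate-1 : ∀ k → sum (replicate k 1) ≡ k
sum-replicate-1 zero    = refl
sum-replicate-1 (suc k) = cong suc (sum-replicate-1 k)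

2*length≤sum : ∀ {xs} → All (2 ≤_) xs → 2 * length xs ≤ sum xs
2*length≤sum []              = z≤n
2*length≤sum {x ∷ xs} (x≥2 ∷ xs≥2) = subst (_≤ x + sum xs) (sym (*-suc 2 (length xs))) (+-mono-≤ x≥2 (2*length≤sum xs≥2))

sum≡2*length : ∀ {xs} → All (_≡ 2) xs → sum xs ≡ 2 * length xs
sum≡2*length []               = refl
sum≡2*length {_ ∷ xs} (refl ∷ xs≡2) = trans (cong (2 +_) (sum≡2*length xs≡2)) (sym (*-suc 2 (length xs)))

head≡2⇔sum≡2*length : ∀ {y ys} → Descending (y ∷ ys) → All (2 ≤_) (y ∷ ys) →
  y ≡ 2 ⇔ sum (y ∷ ys) ≡ 2 * length (y ∷ ys)
head≡2⇔sum≡2*length {y} {ys} (y≥ys ∷ _) (y≥2 ∷ ys≥2) = mk⇔ all-twos head-two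
  where
  all-twos : y ≡ 2 → sum (y ∷ ys) ≡ 2 * length (y ∷ ys)
  all-twos refl = sum≡2*length (refl ∷ All.zipWith (λ (x≤2 , x≥2) → ≤-antisym x≤2 x≥2) (y≥ys , ys≥2))
  head-two : sum (y ∷ ys) ≡ 2 * length (y ∷ ys) → y ≡ 2
  head-two sum≡ = ≤-antisym (+-cancelʳ-≤ (sum ys) y 2 (begin
    y + sum ys           ≡⟨ sum≡ ⟩
    2 * suc (length ys)  ≡⟨ *-suc 2 (length ys) ⟩
    2 + 2 * length ys    ≤⟨ +-monoʳ-≤ 2 (2*length≤sum ys≥2) ⟩
    2 + sum ys           ∎)) y≥2
    where open ≤-Reasoning

take-++-≤ : ∀ {A : Set} k (xs ys : List A) → k ≤ length xs → take k (xs ++ ys) ≡ take k xs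
take-++-≤ zero    xs       ys _         = refl
take-++-≤ (suc k) (x ∷ xs) ys (s≤s k≤) = cong (x ∷_) (take-++-≤ k xs ys k≤)

nth1-++ˡ : ∀ {k} xs ys → k < length xs → nth1 (xs ++ ys) (suc k) ≡ nth1 xs (suc k)
nth1-++ˡ {zero}  (x ∷ xs) ys _         = refl
nth1-++ˡ {suc k} (x ∷ xs) ys (s≤s k<) = nth1-++ˡ xs ys k<

nth1-++ʳ : ∀ xs ys j → nth1 (xs ++ ys) (suc (length xs + j)) ≡ nth1 ys (suc j)
nth1-++ʳ []       ys j = refl
nth1-++ʳ (x ∷ xs) ys j = nth1-++ʳ xs ys j

nth1-replicate : ∀ {j c} x → j < c → nth1 (replicate c x) (suc j) ≡ x
nth1-replicate {zero}  {suc c} x _         = refl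
nth1-replicate {suc j} {suc c} x (s≤s j<) = nth1-replicate x j<

nth1≡2⇔sum-drop : ∀ {k xs} → k < length xs → Descending xs → All (2 ≤_) xs →
  nth1 xs (suc k) ≡ 2 ⇔ sum (drop k xs) ≡ 2 * (length xs ∸ k)
nth1≡2⇔sum-drop {zero}  {y ∷ ys} _         dxs         xs≥2         = head≡2⇔sum≡2*length dxs xs≥2
nth1≡2⇔sum-drop {suc k} {y ∷ ys} (s≤s k<) (_ ∷ dys) (_ ∷ ys≥2) = nth1≡2⇔sum-drop k< dys ys≥2

-- The double Slater number

searchFrom-least : ∀ (P : ℕ → Bool) f t {j} → t ≤ j → P j ≡ true → searchFrom P f t ≤ j
searchFrom-least P zero    t t≤j _ = t≤j
searchFrom-least P (suc f) t {j} t≤j Pj with P t in Pt | m≤n⇒m<n∨m≡n t≤j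
... | true  | _          = t≤j
... | false | inj₁ t<j   = searchFrom-least P f (suc t) t<j Pj
... | false | inj₂ refl  with () ← trans (sym Pt) Pj

searchFrom-found : ∀ (P : ℕ → Bool) f t {j} → t ≤ j → j ≤ f + t → P j ≡ true → P (searchFrom P f t) ≡ true
searchFrom-found P zero    t t≤j j≤t Pj rewrite ≤-antisym t≤j j≤t = Pj
searchFrom-found P (suc f) t {j} t≤j j≤ Pj with P t in Pt | m≤n⇒m<n∨m≡n t≤j
... | true  | _          = Pt
... | false | inj₁ t<j   = searchFrom-found P f (suc t) t<j (subst (j ≤_) (sym (+-suc f t)) j≤) Pj
... | false | inj₂ refl  with () ← trans (sym Pt) Pj

module _ {n : ℕ} (G : Graph n) where

  count-closedNbhd-all : ∀ v → count (inClosedNbhd G v) ≡ suc (deg G v)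
  count-closedNbhd-all v = begin
    count (inClosedNbhd G v)                     ≡⟨ count-cong (λ u → sym (∧-identityʳ (inClosedNbhd G v u))) ⟩
    count (λ u → inClosedNbhd G v u ∧ true)      ≡⟨ count-closedNbhd G v (λ _ → true) ⟩
    suc (count (λ u → adj G v u ∧ true))         ≡⟨ cong suc (count-cong (λ u → ∧-identityʳ (adj G v u))) ⟩
    suc (deg G v)                                ∎
    where open ≡-Reasoning

  SlaterBound : ℕ → Set
  SlaterBound j = 2 * n ≤ j + dsum G (j ∸ ends G) + penults G

  SlCond⇔SlaterBound : ∀ j → SlCond G j ≡ true ⇔ SlaterBound j
  SlCond⇔SlaterBound j = mk⇔
    (λ cond → ≤-trans (m≤n+m∸n (2 * n) p)
      (≤-trans (+-monoʳ-≤ p (≤ᵇ⇒≤ (2 * n ∸ p) x (Equivalence.from T-≡ cond))) (≤-reflexive (+-comm p x))))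
    (λ bound → Equivalence.to T-≡ (≤⇒≤ᵇ (m≤n+o⇒m∸n≤o (2 * n) p (subst (2 * n ≤_) (+-comm _ p) bound))))
    where
    p x : ℕ
    p = penults G
    x = j + dsum G (j ∸ ends G)

  slater2-least : ∀ {j} → SlaterBound j → slater2 G ≤ j
  slater2-least bound = searchFrom-least (SlCond G) (2 * n) 0 z≤n (Equivalence.from (SlCond⇔SlaterBound _) bound)

  SlaterBound-slater2 : SlaterBound n → SlaterBound (slater2 G)
  SlaterBound-slater2 bound = Equivalence.to (SlCond⇔SlaterBound _)
    (searchFrom-found (SlCond G) (2 * n) 0 z≤n (≤-trans (m≤m+n n (n + 0)) (≤-reflexive (sym (+-identityʳ (2 * n)))))
      (Equivalence.from (SlCond⇔SlaterBound n) bound))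

  degSeq≡sort≥ : degSeq G ≡ sort≥ (map (deg G) (allFin n))
  degSeq≡sort≥ = reverse-sort≡sort≥ (map (deg G) (allFin n))

  degSeq-↭ : degSeq G ↭ map (deg G) (allFin n)
  degSeq-↭ = subst (_↭ map (deg G) (allFin n)) (sym degSeq≡sort≥) (sort≥-↭ (map (deg G) (allFin n)))

  degSeq-descending : Descending (degSeq G)
  degSeq-descending = subst Descending (sym degSeq≡sort≥) (sort≥-descending (map (deg G) (allFin n)))

  countOnes-degSeq : countOnes (degSeq G) ≡ ends G
  countOnes-degSeq = trans (sum-↭ (Perm.map⁺ (λ x → ⟦ x ≡ᵇ 1 ⟧) degSeq-↭)) (cong sum (sym (List.map-∘ (allFin n))))

  sum-degSeq : sum (degSeq G) ≡ 2 * size G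
  sum-degSeq = trans (sum-↭ degSeq-↭) (trans (sum-map-allFin (deg G)) (handshake G))

  length-degSeq : length (degSeq G) ≡ n
  length-degSeq = trans (↭-length degSeq-↭) (trans (List.length-map (deg G) (allFin n)) (List.length-tabulate (λ i → i)))

  degreeSum≤dsum : ∀ T → degreeSum G T ≤ dsum G (count T)
  degreeSum≤dsum T = begin
    degreeSum G T                                                  ≡⟨ sum-map-allFin (λ u → if T u then deg G u else 0) ⟨
    sum (map (λ u → if T u then deg G u else 0) (allFin n))         ≤⟨ sum-select≤sum-take-sort≥ T (deg G) (allFin n) ⟩
    sum (take (count T) (sort≥ (map (deg G) (allFin n))))           ≡⟨ cong (λ ds → sum (take (count T) ds)) degSeq≡sort≥ ⟨
    dsum G (count T)                                               ∎
    where open ≤-Reasoning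

  module _ (S : Fin n → Bool) (dd : IsDoubleDominating G S) where

    closedNbhd-of-end⊆S : ∀ {u w} → isEnd G u ≡ true → inClosedNbhd G u w ≡ true → S w ≡ true
    closedNbhd-of-end⊆S {u} {w} end w∈N[u] with S w in Sw
    ... | true  = refl
    ... | false = ⊥-elim (<⇒≱ (subst (count (λ x → inClosedNbhd G u x ∧ S x) <_) N[u]≡2 (count-∧-< w w∈N[u] Sw)) (dd u))
      where
      N[u]≡2 : count (inClosedNbhd G u) ≡ 2
      N[u]≡2 = trans (count-closedNbhd-all u) (cong suc (isEnd⇒deg≡1 G end))

    -- A vertex with an end-neighbour u lies in N[u] ⊆ S, which pays for the indicator.
    2+endNeighbours≤count-closedNbhd : ∀ v →
      2 + endNeighbours G v ≤ count (λ u → inClosedNbhd G v u ∧ S u) + ⟦ 0 <ᵇ endNeighbours G v ⟧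
    2+endNeighbours≤count-closedNbhd v with endNeighbours G v in Yv
    ... | zero  = subst (2 ≤_) (sym (+-identityʳ _)) (dd v)
    ... | suc k = subst (_≤ count (λ u → inClosedNbhd G v u ∧ S u) + 1) (+-comm (2 + k) 1) (+-monoˡ-≤ 1 X≥)
      where
      end-neighbour : ∃ λ u → adj G v u ∧ isEnd G u ≡ true
      end-neighbour = count-witness (λ u → adj G v u ∧ isEnd G u) (subst (0 <_) (sym Yv) (s≤s z≤n))
      u : Fin n
      u = proj₁ end-neighbour
      v∈S : S v ≡ true
      v∈S = closedNbhd-of-end⊆S (∧-conicalʳ _ _ (proj₂ end-neighbour))
              (trans (cong (⌊ v ≟ u ⌋ ∨_) (trans (adj-sym G u v) (∧-conicalˡ _ _ (proj₂ end-neighbour)))) (∨-zeroʳ _))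
      ends⊆S : ∀ x → adj G v x ∧ isEnd G x ≡ true → adj G v x ∧ S x ≡ true
      ends⊆S x h = cong₂ _∧_ (∧-conicalˡ _ _ h)
        (closedNbhd-of-end⊆S (∧-conicalʳ _ _ h) (cong (_∨ adj G x x) (⌊≟⌋-refl x)))
      X≥ : 2 + k ≤ count (λ u → inClosedNbhd G v u ∧ S u)
      X≥ = subst (2 + k ≤_) (sym (trans (count-closedNbhd G v S) (cong (λ b → ⟦ b ⟧ + N[v]∩S) v∈S)))
             (s≤s (subst (_≤ N[v]∩S) Yv (count-mono ends⊆S)))
        where
        N[v]∩S : ℕ
        N[v]∩S = count (λ x → adj G v x ∧ S x)

    S∖ends : Fin n → Bool
    S∖ends u = S u ∧ not (isEnd G u)

    ∑-select-split-ends : ∀ (f : Fin n → ℕ) → ∑[ u < n ] (if S u then f u else 0)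
                           ≡ ∑[ u < n ] (if isEnd G u then f u else 0) + ∑[ u < n ] (if S∖ends u then f u else 0)
    ∑-select-split-ends f = trans (sum-cong-≗ pointwise)
      (∑-distrib-+ (λ u → if isEnd G u then f u else 0) (λ u → if S∖ends u then f u else 0))
      where
      pointwise : ∀ u → (if S u then f u else 0) ≡ (if isEnd G u then f u else 0) + (if S∖ends u then f u else 0)
      pointwise u with isEnd G u in end
      ... | true rewrite closedNbhd-of-end⊆S end (cong (_∨ adj G u u) (⌊≟⌋-refl u)) = sym (+-identityʳ (f u))
      ... | false with S u
      ...   | true  = refl
      ...   | false = refl

    doubleDominating⇒SlaterBound : SlaterBound (count S)
    doubleDominating⇒SlaterBound = +-cancelʳ-≤ e (2 * n) (count S + dsum G (count S ∸ e) + p) (begin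
      2 * n + e
        ≡⟨ cong₂ _+_ (trans (*-comm 2 n) (sym (∑-const n 2))) (sym (∑-endNeighbours G)) ⟩
      ∑[ v < n ] 2 + ∑[ v < n ] Y v                               ≡⟨ ∑-distrib-+ (λ _ → 2) Y ⟨
      ∑[ v < n ] (2 + Y v)                                        ≤⟨ ∑-mono-≤ 2+endNeighbours≤count-closedNbhd ⟩
      ∑[ v < n ] (X v + ⟦ 0 <ᵇ Y v ⟧)                              ≡⟨ ∑-distrib-+ X (λ v → ⟦ 0 <ᵇ Y v ⟧) ⟩
      ∑[ v < n ] X v + ∑[ v < n ] ⟦ 0 <ᵇ Y v ⟧                     ≡⟨ cong₂ _+_ ∑X≡ (sym (count≡∑ (λ v → 0 <ᵇ Y v))) ⟩
      count S + degreeSum G S + p                                 ≡⟨ cong (λ x → count S + x + p) degreeSum-S ⟩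
      count S + (e + degreeSum G S∖ends) + p
        ≤⟨ +-monoˡ-≤ p (+-monoʳ-≤ (count S) (+-monoʳ-≤ e (degreeSum≤dsum S∖ends))) ⟩
      count S + (e + dsum G (count S∖ends)) + p                   ≡⟨ cong (λ k → count S + (e + dsum G k) + p) count-S∖ends ⟩
      count S + (e + dsum G (count S ∸ e)) + p                    ≡⟨ rearrange (count S) e (dsum G (count S ∸ e)) p ⟩
      count S + dsum G (count S ∸ e) + p + e                      ∎)
      where
      open ≤-Reasoning
      e p : ℕ
      e = ends G
      p = penults G
      Y : Fin n → ℕ
      Y = endNeighbours G
      X : Fin n → ℕ
      X v = count (λ u → inClosedNbhd G v u ∧ S u)
      ∑X≡ : ∑[ v < n ] X v ≡ count S + degreeSum G S
      ∑X≡ = begin-equality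
        ∑[ v < n ] X v                                                       ≡⟨ sum-cong-≗ (λ v → count-closedNbhd G v S) ⟩
        ∑[ v < n ] (⟦ S v ⟧ + count (λ u → adj G v u ∧ S u))
          ≡⟨ ∑-distrib-+ (λ v → ⟦ S v ⟧) (λ v → count (λ u → adj G v u ∧ S u)) ⟩
        ∑[ v < n ] ⟦ S v ⟧ + ∑[ v < n ] count (λ u → adj G v u ∧ S u)
          ≡⟨ cong₂ _+_ (sym (count≡∑ S)) (∑-count-adj G S) ⟩
        count S + degreeSum G S                                             ∎
      degreeSum-S : degreeSum G S ≡ e + degreeSum G S∖ends
      degreeSum-S = trans (∑-select-split-ends (deg G)) (cong (_+ degreeSum G S∖ends) (degreeSum-ends G))
      count-S : count S ≡ e + count S∖ends
      count-S = begin-equality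
        count S                                                             ≡⟨ count≡∑ S ⟩
        ∑[ u < n ] ⟦ S u ⟧                                                   ≡⟨ ∑-select-split-ends (λ _ → 1) ⟩
        ∑[ u < n ] ⟦ isEnd G u ⟧ + ∑[ u < n ] ⟦ S∖ends u ⟧
          ≡⟨ cong₂ _+_ (count≡∑ (isEnd G)) (count≡∑ S∖ends) ⟨
        e + count S∖ends                                                    ∎
      count-S∖ends : count S∖ends ≡ count S ∸ e
      count-S∖ends = sym (trans (cong (_∸ e) count-S) (m+n∸m≡n e (count S∖ends)))
      rearrange : ∀ s e d p → s + (e + d) + p ≡ s + d + p + e
      rearrange = solve-∀

slack-identity : ∀ {n k c e t D R M p s₁ s₂} → n ≡ k + c + e → t ≡ e + k → M ≡ D + R + e →
  2 * n + s₁ ≡ t + D + p → 2 * c + s₂ ≡ R → 3 * t + (M + p) ≡ 4 * n + e + (s₁ + s₂)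
slack-identity {k = k} {c} {e} {D = D} {p = p} {s₁} {s₂} refl refl refl slack₁ refl = begin
  3 * (e + k) + (D + (2 * c + s₂) + e + p)       ≡⟨ rearrangeˡ e k D c s₂ p ⟩
  2 * (e + k) + (e + k + D + p) + 2 * c + s₂ + e  ≡⟨ cong (λ x → 2 * (e + k) + x + 2 * c + s₂ + e) slack₁ ⟨
  2 * (e + k) + (2 * (k + c + e) + s₁) + 2 * c + s₂ + e ≡⟨ rearrangeʳ e k c s₁ s₂ ⟩
  4 * (k + c + e) + e + (s₁ + s₂)                 ∎
  where
  open ≡-Reasoning
  rearrangeˡ : ∀ e k D c s₂ p → 3 * (e + k) + (D + (2 * c + s₂) + e + p) ≡ 2 * (e + k) + (e + k + D + p) + 2 * c + s₂ + e
  rearrangeˡ = solve-∀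
  rearrangeʳ : ∀ e k c s₁ s₂ → 2 * (e + k) + (2 * (k + c + e) + s₁) + 2 * c + s₂ + e ≡ 4 * (k + c + e) + e + (s₁ + s₂)
  rearrangeʳ = solve-∀

tight-excess : ∀ {n k c e t X} → n ≡ k + c + e → t ≡ e + k → 3 * t + X ≡ 4 * n + e → X ≡ n + e + 3 * c
tight-excess {k = k} {c} {e} {X = X} refl refl tight =
  +-cancelˡ-≡ (3 * (e + k)) X _ (trans tight (rearrange k c e))
  where
  rearrange : ∀ k c e → 4 * (k + c + e) + e ≡ 3 * (e + k) + (k + c + e + e + 3 * c)
  rearrange = solve-∀

pivot-equation : ∀ {n k c e M p} → n ≡ k + c + e → M + p ≡ n + e + 3 * c → 3 * suc k + (M + 2 * e + p) ≡ 4 * n + 3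
pivot-equation {k = k} {c} {e} {M} {p} refl excess = begin
  3 * suc k + (M + 2 * e + p)                ≡⟨ rearrange M e p k ⟩
  3 * suc k + 2 * e + (M + p)                ≡⟨ cong (3 * suc k + 2 * e +_) excess ⟩
  3 * suc k + 2 * e + (k + c + e + e + 3 * c) ≡⟨ rearrange′ k c e ⟩
  4 * (k + c + e) + 3                        ∎
  where
  open ≡-Reasoning
  rearrange : ∀ M e p k → 3 * suc k + (M + 2 * e + p) ≡ 3 * suc k + 2 * e + (M + p)
  rearrange = solve-∀
  rearrange′ : ∀ k c e → 3 * suc k + 2 * e + (k + c + e + e + 3 * c) ≡ 4 * (k + c + e) + 3
  rearrange′ = solve-∀

pivot-equation⁻¹ : ∀ {n k c e M D p} → n ≡ k + c + e → M ≡ D + 2 * c + e → 3 * suc k + (M + 2 * e + p) ≡ 4 * n + 3 →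
  e + k + D + p ≡ 2 * n × 3 * (e + k) + (M + p) ≡ 4 * n + e
pivot-equation⁻¹ {k = k} {c} {e} {D = D} {p} refl refl pivot = lhs≡ , tight≡
  where
  D+p≡ : D + p ≡ k + 2 * c + e
  D+p≡ = +-cancelˡ-≡ (3 + 3 * k + 2 * c + 3 * e) _ _ (trans (sym (r₁ k D c e p)) (trans pivot (r₂ k c e)))
    where
    r₁ : ∀ k D c e p → 3 * suc k + (D + 2 * c + e + 2 * e + p) ≡ 3 + 3 * k + 2 * c + 3 * e + (D + p)
    r₁ = solve-∀
    r₂ : ∀ k c e → 4 * (k + c + e) + 3 ≡ 3 + 3 * k + 2 * c + 3 * e + (k + 2 * c + e)
    r₂ = solve-∀
  lhs≡ : e + k + D + p ≡ 2 * (k + c + e)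
  lhs≡ = trans (+-assoc (e + k) D p) (trans (cong (e + k +_) D+p≡) (r e k c))
    where
    r : ∀ e k c → e + k + (k + 2 * c + e) ≡ 2 * (k + c + e)
    r = solve-∀
  tight≡ : 3 * (e + k) + (D + 2 * c + e + p) ≡ 4 * (k + c + e) + e
  tight≡ = trans (r e k D c p) (trans (cong (3 * (e + k) + 2 * c + e +_) D+p≡) (r′ e k c))
    where
    r : ∀ e k D c p → 3 * (e + k) + (D + 2 * c + e + p) ≡ 3 * (e + k) + 2 * c + e + (D + p)
    r = solve-∀
    r′ : ∀ e k c → 3 * (e + k) + 2 * c + e + (k + 2 * c + e) ≡ 4 * (k + c + e) + e
    r′ = solve-∀

balanced-equation : ∀ {n e X} → n + e ≡ X → 3 * n + X ≡ 4 * n + e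
balanced-equation {n} {e} refl = r n e
  where
  r : ∀ n e → 3 * n + (n + e) ≡ 4 * n + e
  r = solve-∀

squeeze : ∀ {t t₀ X Y} → t ≤ t₀ → Y ≤ 3 * t + X → 3 * t₀ + X ≡ Y → 3 * t + X ≡ Y
squeeze {t} {t₀} {X} t≤t₀ Y≤ refl = cong (λ s → 3 * s + X) (≤-antisym t≤t₀ t₀≤t)
  where
  t₀≤t : t₀ ≤ t
  t₀≤t = *-cancelˡ-≤ 3 (+-cancelʳ-≤ X (3 * t₀) (3 * t) Y≤)

positive-excess : ∀ {n c M} → 1 ≤ n → 2 * n ≤ M → M ≡ n + 3 * c → 0 < c
positive-excess {n} {zero} 1≤n 2n≤M refl with ≤-trans 1≤n (≤-trans (m≤m+n n 0) (+-cancelˡ-≤ n (n + 0) 0 2n≤M))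
... | ()
positive-excess {c = suc c} _ _ _ = s≤s z≤n

-- Graphs without isolated vertices

module NoIsolatedVertices {n : ℕ} (G : Graph n) (δ : ∀ v → 1 ≤ deg G v) where

  m e p t : ℕ
  m = size G
  e = ends G
  p = penults G
  t = slater2 G

  degSeq-positive : All (1 ≤_) (degSeq G)
  degSeq-positive = All-resp-↭ (↭-sym (degSeq-↭ G)) (All.map⁺ (All.tabulate⁺ δ))

  private
    split : Σ (List ℕ) λ ys → degSeq G ≡ ys ++ replicate (countOnes (degSeq G)) 1 × All (2 ≤_) ys × Descending ys
    split = descending-split-ones (degSeq G) (degSeq-descending G) degSeq-positive

  A : List ℕ
  A = proj₁ split

  a : ℕ
  a = length A

  degSeq≡A++ones : degSeq G ≡ A ++ replicate e 1
  degSeq≡A++ones = subst (λ o → degSeq G ≡ A ++ replicate o 1) (countOnes-degSeq G) (proj₁ (proj₂ split))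

  A≥2 : All (2 ≤_) A
  A≥2 = proj₁ (proj₂ (proj₂ split))

  A-descending : Descending A
  A-descending = proj₂ (proj₂ (proj₂ split))

  n≡a+e : n ≡ a + e
  n≡a+e = begin
    n                               ≡⟨ length-degSeq G ⟨
    length (degSeq G)               ≡⟨ cong length degSeq≡A++ones ⟩
    length (A ++ replicate e 1)     ≡⟨ List.length-++ A ⟩
    a + length (replicate e 1)      ≡⟨ cong (a +_) (List.length-replicate e) ⟩
    a + e                           ∎
    where open ≡-Reasoning

  2m≡sumA+e : 2 * m ≡ sum A + e
  2m≡sumA+e = begin
    2 * m                           ≡⟨ sum-degSeq G ⟨
    sum (degSeq G)                  ≡⟨ cong sum degSeq≡A++ones ⟩
    sum (A ++ replicate e 1)        ≡⟨ sum-++ A (replicate e 1) ⟩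
    sum A + sum (replicate e 1)     ≡⟨ cong (sum A +_) (sum-replicate-1 e) ⟩
    sum A + e                       ∎
    where open ≡-Reasoning

  dsum≡sum-take : ∀ {k} → k ≤ a → dsum G k ≡ sum (take k A)
  dsum≡sum-take {k} k≤a = cong sum (trans (cong (take k) degSeq≡A++ones) (take-++-≤ k A (replicate e 1) k≤a))

  d≡nth1-A : ∀ {k} → k < a → d G (suc k) ≡ nth1 A (suc k)
  d≡nth1-A k<a = trans (cong (λ ds → nth1 ds _) degSeq≡A++ones) (nth1-++ˡ A (replicate e 1) k<a)

  d≡1 : ∀ {k} → a ≤ k → suc k ≤ n → d G (suc k) ≡ 1
  d≡1 {k} a≤k k<n = begin
    d G (suc k)                                      ≡⟨ cong (λ ds → nth1 ds (suc k)) degSeq≡A++ones ⟩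
    nth1 (A ++ replicate e 1) (suc k)                ≡⟨ cong (λ i → nth1 (A ++ replicate e 1) (suc i)) (m+[n∸m]≡n a≤k) ⟨
    nth1 (A ++ replicate e 1) (suc (a + (k ∸ a)))    ≡⟨ nth1-++ʳ A (replicate e 1) (k ∸ a) ⟩
    nth1 (replicate e 1) (suc (k ∸ a))               ≡⟨ nth1-replicate 1 k∸a<e ⟩
    1                                                ∎
    where
    open ≡-Reasoning
    k∸a<e : k ∸ a < e
    k∸a<e = +-cancelˡ-< a (k ∸ a) e (subst₂ _<_ (sym (m+[n∸m]≡n a≤k)) n≡a+e k<n)

  d≡2⇔sum-drop : ∀ {k} → k < a → d G (suc k) ≡ 2 ⇔ sum (drop k A) ≡ 2 * (a ∸ k)
  d≡2⇔sum-drop {k} k<a =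
    subst (λ x → x ≡ 2 ⇔ sum (drop k A) ≡ 2 * (a ∸ k)) (sym (d≡nth1-A k<a)) (nth1≡2⇔sum-drop k<a A-descending A≥2)

  full-doubleDominating : IsDoubleDominating G (λ _ → true)
  full-doubleDominating v =
    subst (2 ≤_) (trans (sym (count-closedNbhd-all G v)) (count-cong (λ u → sym (∧-identityʳ (inClosedNbhd G v u))))) (s≤s (δ v))

  SlaterBound-n : SlaterBound G n
  SlaterBound-n = subst (SlaterBound G) count-true (doubleDominating⇒SlaterBound G (λ _ → true) full-doubleDominating)

  t-SlaterBound : SlaterBound G t
  t-SlaterBound = SlaterBound-slater2 G SlaterBound-n

  e≤t : e ≤ t
  e≤t = ≮⇒≥ λ t<e → <⇒≱ (below t<e) t-SlaterBound
    where
    below : t < e → t + dsum G (t ∸ e) + p < 2 * n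
    below t<e rewrite m≤n⇒m∸n≡0 (<⇒≤ t<e) | +-identityʳ t | +-identityʳ n =
      +-mono-<-≤ (≤-trans t<e (count≤n (isEnd G))) (count≤n _)

  k : ℕ
  k = t ∸ e

  t≡e+k : t ≡ e + k
  t≡e+k = sym (m+[n∸m]≡n e≤t)

  k≤a : k ≤ a
  k≤a = +-cancelˡ-≤ e k a (subst₂ _≤_ t≡e+k (trans n≡a+e (+-comm a e)) (slater2-least G SlaterBound-n))

  c : ℕ
  c = a ∸ k

  n≡k+c+e : n ≡ k + c + e
  n≡k+c+e = trans n≡a+e (cong (_+ e) (sym (m+[n∸m]≡n k≤a)))

  2m≡take+drop+e : ∀ k′ → 2 * m ≡ sum (take k′ A) + sum (drop k′ A) + e
  2m≡take+drop+e k′ = trans 2m≡sumA+e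
    (cong (_+ e) (trans (cong sum (sym (List.take++drop≡id k′ A))) (sum-++ (take k′ A) (drop k′ A))))

  2c≤sum-drop : 2 * c ≤ sum (drop k A)
  2c≤sum-drop = subst (λ l → 2 * l ≤ sum (drop k A)) (List.length-drop k A) (2*length≤sum (All.drop⁺ k A≥2))

  Tight : Set
  Tight = 3 * t + (2 * m + p) ≡ 4 * n + e

  private
    slack₁ : ∃ λ s → 2 * n + s ≡ t + sum (take k A) + p
    slack₁ = m≤n⇒∃[o]m+o≡n (subst (λ x → 2 * n ≤ t + x + p) (dsum≡sum-take k≤a) t-SlaterBound)
    slack₂ : ∃ λ s → 2 * c + s ≡ sum (drop k A)
    slack₂ = m≤n⇒∃[o]m+o≡n 2c≤sum-drop

  slack-eq : 3 * t + (2 * m + p) ≡ 4 * n + e + (proj₁ slack₁ + proj₁ slack₂)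
  slack-eq = slack-identity n≡k+c+e t≡e+k (2m≡take+drop+e k) (proj₂ slack₁) (proj₂ slack₂)

  lower-bound : 4 * n + e ≤ 3 * t + (2 * m + p)
  lower-bound = subst (4 * n + e ≤_) (sym slack-eq) (m≤m+n _ _)

  tight⇒sum-drop : Tight → sum (drop k A) ≡ 2 * c
  tight⇒sum-drop tight = trans (sym (proj₂ slack₂)) (trans (cong (2 * c +_) s₂≡0) (+-identityʳ _))
    where
    s₂≡0 : proj₁ slack₂ ≡ 0
    s₂≡0 = m+n≡0⇒n≡0 (proj₁ slack₁) (+-cancelˡ-≡ (4 * n + e) _ 0 (trans (sym slack-eq) (trans tight (sym (+-identityʳ _)))))

  tight⇒excess : Tight → 2 * m + p ≡ n + e + 3 * c
  tight⇒excess = tight-excess n≡k+c+e t≡e+k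

  -- The requirements on q in (i) and (ii), with M = 2m and M = 2m + 2e + p respectively.
  Pivot : ℕ → ℕ → Set
  Pivot M q = 3 * q + M ≡ 4 * n + 3 × 1 ≤ q × q ≤ n × d G q ≡ 2

  tight⇒pivot : Tight → 0 < c → Pivot (2 * m + 2 * e + p) (suc k)
  tight⇒pivot tight 0<c =
    pivot-equation {k = k} {c} {e} {2 * m} {p} n≡k+c+e (tight⇒excess tight) , s≤s z≤n , ≤-trans k<a a≤n ,
    Equivalence.from (d≡2⇔sum-drop k<a) (tight⇒sum-drop tight)
    where
    k<a : k < a
    k<a = m∸n≢0⇒n<m (λ c≡0 → <⇒≢ 0<c (sym c≡0))
    a≤n : a ≤ n
    a≤n = subst (a ≤_) (sym n≡a+e) (m≤m+n a e)

  witness⇒tight : ∀ {t₀} → SlaterBound G t₀ → 3 * t₀ + (2 * m + p) ≡ 4 * n + e → Tight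
  witness⇒tight bound eq = squeeze (slater2-least G bound) lower-bound eq

  balanced⇒tight : n + e ≡ 2 * m + p → Tight
  balanced⇒tight balanced = witness⇒tight SlaterBound-n (balanced-equation {n} {e} balanced)

  pivot⇒tight : ∀ {q} → Pivot (2 * m + 2 * e + p) q → Tight
  pivot⇒tight {suc k₀} (pivot , s≤s z≤n , q≤n , d≡2) = witness⇒tight bound (proj₂ equations)
    where
    k₀<a : k₀ < a
    k₀<a = ≰⇒> λ a≤k₀ → 1≢2 (trans (sym (d≡1 a≤k₀ q≤n)) d≡2)
      where
      1≢2 : 1 ≢ 2
      1≢2 ()
    c₀ : ℕ
    c₀ = a ∸ k₀
    n≡k₀+c₀+e : n ≡ k₀ + c₀ + e
    n≡k₀+c₀+e = trans n≡a+e (cong (_+ e) (sym (m+[n∸m]≡n (<⇒≤ k₀<a))))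
    2m≡ : 2 * m ≡ sum (take k₀ A) + 2 * c₀ + e
    2m≡ = trans (2m≡take+drop+e k₀) (cong (λ r → sum (take k₀ A) + r + e) (Equivalence.to (d≡2⇔sum-drop k₀<a) d≡2))
    equations : e + k₀ + sum (take k₀ A) + p ≡ 2 * n × 3 * (e + k₀) + (2 * m + p) ≡ 4 * n + e
    equations = pivot-equation⁻¹ {D = sum (take k₀ A)} {p} n≡k₀+c₀+e 2m≡ pivot
    bound : SlaterBound G (e + k₀)
    bound = ≤-reflexive (sym (trans (cong (λ x → e + k₀ + dsum G x + p) (m+n∸m≡n e k₀))
      (trans (cong (λ x → e + k₀ + x + p) (dsum≡sum-take (<⇒≤ k₀<a))) (proj₁ equations))))

-- Integer formulation

-- Opened only now: with the prefix operator +_ in scope, ℕ sections such as (x +_) no longer parse.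
open ℤ using (ℤ; +_; _-_)

i+j-j≡i : ∀ i j → i ℤ.+ j - j ≡ i
i+j-j≡i = ℤ-Ring.solve-∀

i-j+j≡i : ∀ i j → i - j ℤ.+ j ≡ i
i-j+j≡i = ℤ-Ring.solve-∀

pos≡pos-pos⇔ : ∀ x P N → + x ≡ + P - + N ⇔ x + N ≡ P
pos≡pos-pos⇔ x P N = mk⇔ (λ eq → ℤₚ.+-injective (trans (cong (ℤ._+ + N) eq) (i-j+j≡i (+ P) (+ N))))
                       (λ { refl → sym (i+j-j≡i (+ x) (+ N)) })

pos-pos≤pos : ∀ x P N → P ≤ x + N → + P - + N ℤ.≤ + x
pos-pos≤pos x P N P≤ = subst (+ P - + N ℤ.≤_) (i+j-j≡i (+ x) (+ N)) (ℤₚ.+-monoˡ-≤ (ℤ.- + N) (ℤ.+≤+ P≤))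

pos<pos-pos : ∀ x P N → x + N < P → + x ℤ.< + P - + N
pos<pos-pos x P N <P = subst (ℤ._< + P - + N) (i+j-j≡i (+ x) (+ N)) (ℤₚ.+-monoˡ-< (ℤ.- + N) (ℤ.+<+ <P))

3*pos≡pos-pos⇔ : ∀ {E} t P N → E ≡ + P - + N → (+ 3) ℤ.* (+ t) ≡ E ⇔ 3 * t + N ≡ P
3*pos≡pos-pos⇔ t P N E≡ = mk⇔ (λ eq → Equivalence.to (pos≡pos-pos⇔ (3 * t) P N) (trans (ℤₚ.pos-* 3 t) (trans eq E≡)))
                    (λ eq → trans (sym (ℤₚ.pos-* 3 t)) (trans (Equivalence.from (pos≡pos-pos⇔ (3 * t) P N) eq) (sym E≡)))

tight-normal : ∀ n m e p → (+ 4) ℤ.* (+ n) - (+ 2) ℤ.* (+ m) ℤ.+ (+ e) - (+ p) ≡ + (4 * n + e) - + (2 * m + p)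
tight-normal n m e p = trans (r (+ 4 ℤ.* + n) (+ 2 ℤ.* + m) (+ e) (+ p))
  (sym (cong₂ (λ a b → (a ℤ.+ + e) - (b ℤ.+ + p)) (ℤₚ.pos-* 4 n) (ℤₚ.pos-* 2 m)))
  where
  r : ∀ a b e p → a - b ℤ.+ e - p ≡ (a ℤ.+ e) - (b ℤ.+ p)
  r = ℤ-Ring.solve-∀

regular-pivot-normal : ∀ n m → (+ 4) ℤ.* (+ n) - (+ 2) ℤ.* (+ m) ℤ.+ (+ 3) ≡ + (4 * n + 3) - + (2 * m)
regular-pivot-normal n m = trans (r (+ 4 ℤ.* + n) (+ 2 ℤ.* + m))
  (sym (cong₂ (λ a b → (a ℤ.+ + 3) - b) (ℤₚ.pos-* 4 n) (ℤₚ.pos-* 2 m)))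
  where
  r : ∀ a b → a - b ℤ.+ + 3 ≡ (a ℤ.+ + 3) - b
  r = ℤ-Ring.solve-∀

balanced-normal : ∀ m e p → (+ 2) ℤ.* (+ m) - (+ e) ℤ.+ (+ p) ≡ + (2 * m + p) - + e
balanced-normal m e p = trans (r (+ 2 ℤ.* + m) (+ e) (+ p)) (sym (cong (λ a → (a ℤ.+ + p) - + e) (ℤₚ.pos-* 2 m)))
  where
  r : ∀ a e p → a - e ℤ.+ p ≡ (a ℤ.+ p) - e
  r = ℤ-Ring.solve-∀

pivot-normal : ∀ n m e p → (+ 4) ℤ.* (+ n) - (+ 2) ℤ.* (+ m) - (+ 2) ℤ.* (+ e) - (+ p) ℤ.+ (+ 3)
                         ≡ + (4 * n + 3) - + (2 * m + 2 * e + p)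
pivot-normal n m e p = trans (r (+ 4 ℤ.* + n) (+ 2 ℤ.* + m) (+ 2 ℤ.* + e) (+ p))
  (sym (cong₂ (λ a bc → (a ℤ.+ + 3) - (bc ℤ.+ + p)) (ℤₚ.pos-* 4 n) (cong₂ ℤ._+_ (ℤₚ.pos-* 2 m) (ℤₚ.pos-* 2 e))))
  where
  r : ∀ a b c p → a - b - c - p ℤ.+ + 3 ≡ (a ℤ.+ + 3) - (b ℤ.+ c ℤ.+ p)
  r = ℤ-Ring.solve-∀

excess⇒3∣n+m+e-p : ∀ {n m e p c} → 2 * m + p ≡ n + e + 3 * c → + 3 ∣ (+ n) ℤ.+ (+ m) ℤ.+ (+ e) - (+ p)
excess⇒3∣n+m+e-p {n} {m} {e} {p} {c} excess =
  divides ℤ.∣ w ∣ (trans (cong ℤ.∣_∣ E≡3w) (trans (ℤₚ.abs-* (+ 3) w) (*-comm 3 ℤ.∣ w ∣)))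
  where
  w : ℤ
  w = + m - + c
  2m+p : ℤ
  2m+p = + 2 ℤ.* + m ℤ.+ + p
  excessℤ : 2m+p ≡ + n ℤ.+ + e ℤ.+ + 3 ℤ.* + c
  excessℤ = trans (cong (ℤ._+ + p) (sym (ℤₚ.pos-* 2 m)))
              (trans (cong +_ excess) (cong (λ x → + n ℤ.+ + e ℤ.+ x) (ℤₚ.pos-* 3 c)))
  r : ∀ n m e p c → n ℤ.+ m ℤ.+ e - p ≡ (n ℤ.+ e ℤ.+ + 3 ℤ.* c) - (+ 2 ℤ.* m ℤ.+ p) ℤ.+ + 3 ℤ.* (m - c)
  r = ℤ-Ring.solve-∀
  y-y+z≡z : ∀ y z → y - y ℤ.+ z ≡ z
  y-y+z≡z = ℤ-Ring.solve-∀
  E≡3w : (+ n) ℤ.+ (+ m) ℤ.+ (+ e) - (+ p) ≡ + 3 ℤ.* w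
  E≡3w = begin
    + n ℤ.+ + m ℤ.+ + e - + p                                      ≡⟨ r (+ n) (+ m) (+ e) (+ p) (+ c) ⟩
    (+ n ℤ.+ + e ℤ.+ + 3 ℤ.* + c) - 2m+p ℤ.+ + 3 ℤ.* w              ≡⟨ cong (λ x → x - 2m+p ℤ.+ + 3 ℤ.* w) excessℤ ⟨
    2m+p - 2m+p ℤ.+ + 3 ℤ.* w                                      ≡⟨ y-y+z≡z 2m+p (+ 3 ℤ.* w) ⟩
    + 3 ℤ.* w                                                      ∎
    where open ≡-Reasoning

module IntegerForm {n : ℕ} (G : Graph n) (n≥1 : 1 ≤ n) (δ : ∀ v → 1 ≤ deg G v) where

  open NoIsolatedVertices G δ

  RegularCondition : Set
  RegularCondition = Σ ℕ λ q → ((+ 3) ℤ.* (+ q) ≡ (+ 4) ℤ.* (+ n) - (+ 2) ℤ.* (+ m) ℤ.+ (+ 3))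
                               × 1 ≤ q × q ≤ n × d G q ≡ 2

  PendantCondition : Set
  PendantCondition =
    ((+ n) ≡ (+ 2) ℤ.* (+ m) - (+ e) ℤ.+ (+ p)) ⊎
    (((+ n) ℤ.< (+ 2) ℤ.* (+ m) - (+ e) ℤ.+ (+ p)) ×
     Σ ℕ λ q → ((+ 3) ℤ.* (+ q) ≡ (+ 4) ℤ.* (+ n) - (+ 2) ℤ.* (+ m) - (+ 2) ℤ.* (+ e) - (+ p) ℤ.+ (+ 3))
               × 1 ≤ q × q ≤ n × d G q ≡ 2)

  Conditions : Set
  Conditions = (+ 3 ∣ ((+ n) ℤ.+ (+ m) ℤ.+ (+ e) - (+ p)))
             × ((∀ v → 2 ≤ deg G v) → RegularCondition)
             × ((∃ λ v → deg G v ≡ 1) → PendantCondition)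

  tight⇔ : (+ 3) ℤ.* (+ t) ≡ (+ 4) ℤ.* (+ n) - (+ 2) ℤ.* (+ m) ℤ.+ (+ e) - (+ p) ⇔ Tight
  tight⇔ = 3*pos≡pos-pos⇔ t (4 * n + e) (2 * m + p) (tight-normal n m e p)

  pivot⇔ : ∀ q → (+ 3) ℤ.* (+ q) ≡ (+ 4) ℤ.* (+ n) - (+ 2) ℤ.* (+ m) - (+ 2) ℤ.* (+ e) - (+ p) ℤ.+ (+ 3)
                  ⇔ 3 * q + (2 * m + 2 * e + p) ≡ 4 * n + 3
  pivot⇔ q = 3*pos≡pos-pos⇔ q (4 * n + 3) (2 * m + 2 * e + p) (pivot-normal n m e p)

  regular-pivot⇔ : (∀ v → 2 ≤ deg G v) → ∀ q → (+ 3) ℤ.* (+ q) ≡ (+ 4) ℤ.* (+ n) - (+ 2) ℤ.* (+ m) ℤ.+ (+ 3)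
                                                  ⇔ 3 * q + (2 * m + 2 * e + p) ≡ 4 * n + 3
  regular-pivot⇔ δ≥2 q =
    subst (λ M → (+ 3) ℤ.* (+ q) ≡ (+ 4) ℤ.* (+ n) - (+ 2) ℤ.* (+ m) ℤ.+ (+ 3) ⇔ 3 * q + M ≡ 4 * n + 3)
          (sym 2m+2e+p≡2m) (3*pos≡pos-pos⇔ q (4 * n + 3) (2 * m) (regular-pivot-normal n m))
    where
    2m+2e+p≡2m : 2 * m + 2 * e + p ≡ 2 * m
    2m+2e+p≡2m rewrite ends≡0 G δ≥2 | penults≡0 G δ≥2 = trans (+-identityʳ _) (+-identityʳ _)

  slater2≤γ×2 : ∀ k → IsDoubleDomNumber G k → t ≤ k
  slater2≤γ×2 k ((S , dd , |S|≡k) , _) = subst (t ≤_) |S|≡k (slater2-least G (doubleDominating⇒SlaterBound G S dd))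

  lower-boundℤ : (+ 4) ℤ.* (+ n) - (+ 2) ℤ.* (+ m) ℤ.+ (+ e) - (+ p) ℤ.≤ (+ 3) ℤ.* (+ t)
  lower-boundℤ = subst₂ ℤ._≤_ (sym (tight-normal n m e p)) (ℤₚ.pos-* 3 t) (pos-pos≤pos (3 * t) (4 * n + e) (2 * m + p) lower-bound)

  tight⇒conditions : Tight → Conditions
  tight⇒conditions tight = excess⇒3∣n+m+e-p {n} {m} {e} {p} {c} excess , regular , λ _ → pendant (0 <? c)
    where
    excess : 2 * m + p ≡ n + e + 3 * c
    excess = tight⇒excess tight
    regular : (∀ v → 2 ≤ deg G v) → RegularCondition
    regular δ≥2 = suc k , Equivalence.from (regular-pivot⇔ δ≥2 (suc k)) (proj₁ pivot) , proj₂ pivot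
      where
      2m≡n+3c : 2 * m ≡ n + 3 * c
      2m≡n+3c = begin
        2 * m           ≡⟨ +-identityʳ (2 * m) ⟨
        2 * m + 0       ≡⟨ cong (λ x → 2 * m + x) (penults≡0 G δ≥2) ⟨
        2 * m + p       ≡⟨ excess ⟩
        n + e + 3 * c   ≡⟨ cong (λ x → n + x + 3 * c) (ends≡0 G δ≥2) ⟩
        n + 0 + 3 * c   ≡⟨ cong (_+ 3 * c) (+-identityʳ n) ⟩
        n + 3 * c       ∎
        where open ≡-Reasoning
      pivot : Pivot (2 * m + 2 * e + p) (suc k)
      pivot = tight⇒pivot tight (positive-excess n≥1 (2n≤2m G δ≥2) 2m≡n+3c)
    pendant : Dec (0 < c) → PendantCondition
    pendant (no c≯0) = inj₁ (trans (Equivalence.from (pos≡pos-pos⇔ n (2 * m + p) e) balanced) (sym (balanced-normal m e p)))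
      where
      balanced : n + e ≡ 2 * m + p
      balanced = sym (trans excess (trans (cong (λ x → n + e + 3 * x) (n≤0⇒n≡0 (≮⇒≥ c≯0))) (+-identityʳ (n + e))))
    pendant (yes 0<c) = inj₂ (subst (+ n ℤ.<_) (sym (balanced-normal m e p)) (pos<pos-pos n (2 * m + p) e n+e<2m+p) ,
                              suc k , Equivalence.from (pivot⇔ (suc k)) (proj₁ pivot) , proj₂ pivot)
      where
      pivot : Pivot (2 * m + 2 * e + p) (suc k)
      pivot = tight⇒pivot tight 0<c
      n+e<2m+p : n + e < 2 * m + p
      n+e<2m+p = subst (n + e <_) (sym excess) (m<m+n (n + e) (<-≤-trans 0<c (m≤m+n c (2 * c))))

  no-end⇒δ≥2 : ¬ (∃ λ v → deg G v ≡ 1) → ∀ v → 2 ≤ deg G v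
  no-end⇒δ≥2 no-end v = ≤∧≢⇒< (δ v) (λ 1≡deg → no-end (v , sym 1≡deg))

  conditions⇒tight : Conditions → Tight
  conditions⇒tight (_ , regular , pendant) = by-cases (any? (λ v → deg G v ≟ℕ 1))
    where
    from-pendant : PendantCondition → Tight
    from-pendant (inj₁ balancedℤ) =
      balanced⇒tight (Equivalence.to (pos≡pos-pos⇔ n (2 * m + p) e) (trans balancedℤ (balanced-normal m e p)))
    from-pendant (inj₂ (_ , q , eq , bounds)) = pivot⇒tight (Equivalence.to (pivot⇔ q) eq , bounds)
    from-regular : (δ≥2 : ∀ v → 2 ≤ deg G v) → RegularCondition → Tight
    from-regular δ≥2 (q , eq , bounds) = pivot⇒tight (Equivalence.to (regular-pivot⇔ δ≥2 q) eq , bounds)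
    by-cases : Dec (∃ λ v → deg G v ≡ 1) → Tight
    by-cases (yes end)   = from-pendant (pendant end)
    by-cases (no no-end) = from-regular (no-end⇒δ≥2 no-end) (regular (no-end⇒δ≥2 no-end))

theorem6 : ∀ (n : ℕ) (G : Graph n) → 1 ≤ n → (∀ v → 1 ≤ deg G v) →
    ((∀ k → IsDoubleDomNumber G k → slater2 G ≤ k) ×
     ((+ 4) ℤ.* (+ n) - (+ 2) ℤ.* (+ size G) ℤ.+ (+ ends G) - (+ penults G)) ℤ.≤ ((+ 3) ℤ.* (+ slater2 G))) ×
    (((+ 3) ℤ.* (+ slater2 G) ≡ (+ 4) ℤ.* (+ n) - (+ 2) ℤ.* (+ size G) ℤ.+ (+ ends G) - (+ penults G))
      ⇔
     ((+ 3 ∣ ((+ n) ℤ.+ (+ size G) ℤ.+ (+ ends G) - (+ penults G))) ×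
      ((∀ v → 2 ≤ deg G v) →
         Σ ℕ λ q → ((+ 3) ℤ.* (+ q) ≡ (+ 4) ℤ.* (+ n) - (+ 2) ℤ.* (+ size G) ℤ.+ (+ 3))
                   × 1 ≤ q × q ≤ n × d G q ≡ 2) ×
      ((∃ λ v → deg G v ≡ 1) →
         ((+ n) ≡ (+ 2) ℤ.* (+ size G) - (+ ends G) ℤ.+ (+ penults G)) ⊎
         (((+ n) ℤ.< (+ 2) ℤ.* (+ size G) - (+ ends G) ℤ.+ (+ penults G)) ×
          Σ ℕ λ q → ((+ 3) ℤ.* (+ q) ≡ (+ 4) ℤ.* (+ n) - (+ 2) ℤ.* (+ size G) - (+ 2) ℤ.* (+ ends G) - (+ penults G) ℤ.+ (+ 3))
                    × 1 ≤ q × q ≤ n × d G q ≡ 2))))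
theorem6 n G n≥1 δ =
  (slater2≤γ×2 , lower-boundℤ) , mk⇔ (tight⇒conditions ∘ Equivalence.to tight⇔) (Equivalence.from tight⇔ ∘ conditions⇒tight)
  where open IntegerForm G n≥1 δ
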